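{- Let $\mathbb{K}$ be a field, let $\varphi(z,x)=\sum_{m,n\ge 0}\varphi_{m,n}z^m x^n\in\mathbb{K}[[z,x]]$ be a bivariate formal power series, and let $(B_n)_{n\ge 1}$ be a sequence in $\mathbb{K}$ defining the hook weight $B$. Let $F(z)=F_{\varphi,B}(z)=\sum_{t}w_\varphi(t)B(t)z^{|t|}$, the sum over all decorated plane trees $t$ (defined in the context). Then: (1) for all $n\ge 1$, $[z^n]F(z)=B_n\,[z^{n-1}]\varphi(z,F(z))$; (2) $F(z)=L_B\bigl(\varphi(z,F(z))\bigr)$, where $L_B$ is the $\mathbb{K}$-linear operator on formal power series in $z$ with $L_B(z^n)=B_{n+1}z^{n+1}$ for all $n\ge 0$ (applied coefficientwise); (3) $F'(z)=L_B^*(1+\theta)\bigl(\varphi(z,F(z))\bigr)$, where $L_B^*(1+\theta)$ denotes the $\mathbb{K}$-linear operator on formal power series in $z$ (applied coefficientwise) sending $z^n$ to $(n+1)B_{n+1}z^n$ for all $n\ge 0$, and $\theta=z\frac{d}{dz}$.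
   Context: A decorated plane tree is a finite rooted plane (ordered) tree in which each vertex $v$ is assigned a positive integer size $|v|$; the size $|t|$ of a decorated tree (or forest) is the sum of the sizes of its vertices. For a vertex $v$ of a tree $t$, $t_v$ denotes the subtree of $t$ rooted at $v$ (consisting of $v$ and all its descendants), and $\deg(v)$ denotes the number of children of $v$. The hook weight associated to the sequence $(B_n)_{n\ge1}$ is $B(t)=\prod_{v\in V(t)}B_{|t_v|}$. The weight $w_\varphi(t)=\prod_{v\in V(t)}\varphi_{|v|-1,\deg(v)}$. $[z^n]G(z)$ denotes the coefficient of $z^n$ in the formal power series $G$. -}

module Defs where

open import Level using (Level; _⊔_)
open import Data.Nat as ℕ using (ℕ; zero; suc; _∸_)
open import Data.List using (List; []; _∷_; length)
open import Data.Product using (Σ; ∃; _×_; _,_)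
open import Relation.Nullary using (¬_)
open import Relation.Binary.PropositionalEquality using (_≡_)
open import Data.List.Membership.Propositional using (_∈_)
open import Data.List.Relation.Unary.Unique.Propositional using (Unique)
open import Algebra.Bundles using (CommutativeRing)

record Field (c ℓ : Level) : Set (Level.suc (c ⊔ ℓ)) where
  field
    commutativeRing : CommutativeRing c ℓ
  open CommutativeRing commutativeRing public
  field
    0≉1     : ¬ (0# ≈ 1#)
    inverse : ∀ x → ¬ (x ≈ 0#) → ∃ λ y → x * y ≈ 1#

-- A vertex  node k ts  has size |v| = suc k
-- (so sizes are exactly the positive integers, and |v| - 1 = k) and
-- the ordered list of subtrees ts of its children; deg(v) = length ts.

data Tree : Set where
  node : ℕ → List Tree → Tree

mutual
  size : Tree → ℕ
  size (node k ts) = suc k ℕ.+ sizeF ts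

  sizeF : List Tree → ℕ
  sizeF []       = 0
  sizeF (t ∷ ts) = size t ℕ.+ sizeF ts

IsTreeEnumeration : (ℕ → List Tree) → Set
IsTreeEnumeration enum =
  (∀ n → Unique (enum n)) ×
  (∀ n t → (t ∈ enum n → size t ≡ n) × (size t ≡ n → t ∈ enum n))

-- Formal power series over a commutative ring, as coefficient
-- sequences:  G : ℕ → Carrier  represents  Σ_n G n z^n;
-- a bivariate series φ : ℕ → ℕ → Carrier represents Σ φ m n z^m x^n.

module Series {c ℓ} (R : CommutativeRing c ℓ) where
  open CommutativeRing R

  sumTo : ℕ → (ℕ → Carrier) → Carrier
  sumTo zero    f = 0#
  sumTo (suc n) f = sumTo n f + f n

  sumUpTo : ℕ → (ℕ → Carrier) → Carrier
  sumUpTo n = sumTo (suc n)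

  fromℕ : ℕ → Carrier
  fromℕ zero    = 0#
  fromℕ (suc n) = 1# + fromℕ n

  Series : Set c
  Series = ℕ → Carrier

  zeroS : Series
  zeroS _ = 0#

  oneS : Series
  oneS zero    = 1#
  oneS (suc _) = 0#

  _·_ : Series → Series → Series
  (G · H) n = sumUpTo n (λ i → G i * H (n ∸ i))

  pow : Series → ℕ → Series
  pow G zero    = oneS
  pow G (suc k) = G · pow G k

  -- composition φ(z, G(z)) = Σ_{m,k} φ m k z^m G(z)^k, for G with
  -- zero constant term (then only m ≤ N and k ≤ N contribute to [z^N]).
  compose : (ℕ → ℕ → Carrier) → Series → Series
  compose φ G N = sumUpTo N (λ m → sumUpTo N (λ k → φ m k * pow G k (N ∸ m)))

  deriv : Series → Series
  deriv G n = fromℕ (suc n) * G (suc n)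

  L : (ℕ → Carrier) → Series → Series
  L B G zero    = 0#
  L B G (suc n) = B (suc n) * G n

  Lstar : (ℕ → Carrier) → Series → Series
  Lstar B G n = (fromℕ (suc n) * B (suc n)) * G n

  _≋_ : Series → Series → Set ℓ
  G ≋ H = ∀ n → G n ≈ H n

  -- Weights.  B : ℕ → Carrier with B n = B_n (the value B 0 is never used).

  mutual
    hookB : (ℕ → Carrier) → Tree → Carrier
    hookB B (node k ts) = B (size (node k ts)) * hookBF B ts

    hookBF : (ℕ → Carrier) → List Tree → Carrier
    hookBF B []       = 1#
    hookBF B (t ∷ ts) = hookB B t * hookBF B ts

  mutual
    wφ : (ℕ → ℕ → Carrier) → Tree → Carrier
    wφ φ (node k ts) = φ k (length ts) * wφF φ ts

    wφF : (ℕ → ℕ → Carrier) → List Tree → Carrier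
    wφF φ []       = 1#
    wφF φ (t ∷ ts) = wφ φ t * wφF φ ts

  sumList : List Tree → (Tree → Carrier) → Carrier
  sumList []       f = 0#
  sumList (t ∷ ts) f = f t + sumList ts f

  Fser : (ℕ → ℕ → Carrier) → (ℕ → Carrier) → (ℕ → List Tree) → Series
  Fser φ B enum n = sumList (enum n) (λ t → wφ φ t * hookB B t)

-- A tree of size n+1 is a root of size k+1 carrying an ordered forest of
-- j subtrees of total size n-k.  Its weight factors as
--     w_φ(t) B(t) = B_{n+1} · φ_{k,j} · Π_{subtrees s} w_φ(s) B(s),
-- so, grouping the trees of size n+1 by (k, j), one gets
--     [z^{n+1}] F = B_{n+1} Σ_{k,j} φ_{k,j} [z^{n-k}] F^j = B_{n+1} [z^n] φ(z,F),
-- which is part (1); parts (2) and (3) are its coefficientwise restatements.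
module Submission where

open import Defs
open import Function.Base using (_∘_)
open import Function.Bundles using (_⇔_; mk⇔)
open import Data.Nat as ℕ using (ℕ; zero; suc; _∸_; _≤_; z≤n; s≤s)
open import Data.Nat.Properties
  using (≤-pred; ≤-trans; m≤m+n; m≤n+m; m+n∸m≡n; m+[n∸m]≡n; suc-injective)
open import Data.List using (List; []; _∷_; [_]; _++_; map; foldr; concatMap; upTo; length)
open import Data.List.Properties using (map-∘; upTo-∷ʳ; ∷-injectiveˡ; ∷-injectiveʳ)
open import Data.Product using (_×_; _,_; proj₁; proj₂; ∃)
open import Algebra.Bundles using (CommutativeSemiring; CommutativeRing)
open import Relation.Binary.PropositionalEquality
  using (_≡_; refl; sym; trans; cong; cong₂; subst)
open import Data.List.Relation.Unary.Any using (here; there)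
open import Data.List.Relation.Unary.All as All using ([]; _∷_)
open import Data.List.Relation.Unary.AllPairs using ([]; _∷_)
open import Data.List.Relation.Unary.Unique.Propositional using (Unique)
open import Data.List.Relation.Unary.Unique.Propositional.Properties
  using (++⁺; upTo⁺) renaming (map⁺ to Unique-map⁺)
open import Data.List.Relation.Binary.Disjoint.Propositional using (Disjoint)
open import Data.List.Membership.Propositional using (_∈_; find; lose)
open import Data.List.Membership.Propositional.Properties
  using (∈-concatMap⁺; ∈-concatMap⁻; ∈-map⁺; ∈-map⁻; ∈-upTo⁺; ∈-upTo⁻)
open import Data.List.Membership.Propositional.Properties.WithK using (unique∧set⇒bag)
open import Data.List.Relation.Binary.BagAndSetEquality using (∼bag⇒↭)
open import Data.List.Relation.Binary.Permutation.Propositional using (↭⇒↭ₛ′)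
open import Data.List.Relation.Binary.Permutation.Propositional.Properties
  renaming (map⁺ to ↭-map⁺) using ()
import Data.List.Relation.Binary.Permutation.Setoid.Properties as SetoidPermutation
import Algebra.Properties.CommutativeSemigroup as CommutativeSemigroupProperties

module _ {A B : Set} (g : A → List B) where

  ∈-concatMap-index : ∀ {ks y} → y ∈ concatMap g ks → ∃ λ k → k ∈ ks × y ∈ g k
  ∈-concatMap-index y∈ = find (∈-concatMap⁻ g y∈)

  ∈-concatMap-intro : ∀ {ks k y} → k ∈ ks → y ∈ g k → y ∈ concatMap g ks
  ∈-concatMap-intro k∈ y∈ = ∈-concatMap⁺ g (lose k∈ y∈)

  -- A disjoint union of duplicate-free lists over distinct indices is
  -- duplicate-free; disjointness is phrased as "an element determines its index".
  concatMap-unique : (∀ {k k′ y} → y ∈ g k → y ∈ g k′ → k ≡ k′) →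
                     (∀ k → Unique (g k)) → ∀ {ks} → Unique ks → Unique (concatMap g ks)
  concatMap-unique determines unique-g []              = []
  concatMap-unique determines unique-g {k ∷ ks} (k∉ks ∷ unique-ks) =
    ++⁺ (unique-g k) (concatMap-unique determines unique-g unique-ks) disjoint
    where
    disjoint : Disjoint (g k) (concatMap g ks)
    disjoint (y∈gk , y∈rest) with k′ , k′∈ks , y∈gk′ ← ∈-concatMap-index y∈rest =
      All.lookup k∉ks k′∈ks (determines y∈gk y∈gk′)

-- Finite sums over lists in a commutative semiring

module ListSums {c ℓ} (S : CommutativeSemiring c ℓ) where
  open CommutativeSemiring S hiding (refl; sym; trans)
  open CommutativeSemiring S using () renaming (refl to ≈-refl; sym to ≈-sym; trans to ≈-trans)
  open import Relation.Binary.Reasoning.Setoid setoid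
  open SetoidPermutation setoid using (foldr-commMonoid)

  sumOver : {A : Set} → List A → (A → Carrier) → Carrier
  sumOver xs f = foldr _+_ 0# (map f xs)

  module _ {A : Set} where

    sumOver-cong : ∀ (xs : List A) {f g} → (∀ {x} → x ∈ xs → f x ≈ g x) →
                   sumOver xs f ≈ sumOver xs g
    sumOver-cong []       f≈g = ≈-refl
    sumOver-cong (x ∷ xs) f≈g = +-cong (f≈g (here refl)) (sumOver-cong xs (f≈g ∘ there))

    sumOver-++ : ∀ (xs : List A) {ys} f → sumOver (xs ++ ys) f ≈ sumOver xs f + sumOver ys f
    sumOver-++ []       f = ≈-sym (+-identityˡ _)
    sumOver-++ (x ∷ xs) f = ≈-trans (+-congˡ (sumOver-++ xs f)) (≈-sym (+-assoc _ _ _))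

    sumOver-*ˡ : ∀ a (xs : List A) f → a * sumOver xs f ≈ sumOver xs (λ x → a * f x)
    sumOver-*ˡ a []       f = zeroʳ a
    sumOver-*ˡ a (x ∷ xs) f = ≈-trans (distribˡ a _ _) (+-congˡ (sumOver-*ˡ a xs f))

    sumOver-*ʳ : ∀ a (xs : List A) f → sumOver xs f * a ≈ sumOver xs (λ x → f x * a)
    sumOver-*ʳ a []       f = zeroˡ a
    sumOver-*ʳ a (x ∷ xs) f = ≈-trans (distribʳ a _ _) (+-congˡ (sumOver-*ʳ a xs f))

    -- A sum over a duplicate-free list depends only on the set of its
    -- elements: such lists are permutations of each other.
    sumOver-unique : ∀ {xs ys : List A} f → Unique xs → Unique ys →
                     (∀ {x} → x ∈ xs ⇔ x ∈ ys) → sumOver xs f ≈ sumOver ys f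
    sumOver-unique f unique-xs unique-ys same-elements =
      foldr-commMonoid +-isCommutativeMonoid
        (↭⇒↭ₛ′ isEquivalence (↭-map⁺ f (∼bag⇒↭ (unique∧set⇒bag unique-xs unique-ys same-elements))))

  sumOver-map : ∀ {A B : Set} (h : A → B) xs f → sumOver (map h xs) f ≡ sumOver xs (f ∘ h)
  sumOver-map h xs f = cong (foldr _+_ 0#) (sym (map-∘ xs))

  sumOver-concatMap : ∀ {A B : Set} (g : A → List B) ks f →
                      sumOver (concatMap g ks) f ≈ sumOver ks (λ k → sumOver (g k) f)
  sumOver-concatMap g []       f = ≈-refl
  sumOver-concatMap g (k ∷ ks) f = ≈-trans (sumOver-++ (g k) f) (+-congˡ (sumOver-concatMap g ks f))

-- Duplicate-free enumerations of forests and trees by size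

-- Every tree has size at least 1, so a forest has at most as many trees as its size.
length≤sizeF : ∀ ts → length ts ≤ sizeF ts
length≤sizeF []                = z≤n
length≤sizeF (node k us ∷ ts) =
  s≤s (≤-trans (length≤sizeF ts) (m≤n+m (sizeF ts) (k ℕ.+ sizeF us)))

module TreeEnumeration (enum : ℕ → List Tree) (isE : IsTreeEnumeration enum) where

  enum-unique : ∀ i → Unique (enum i)
  enum-unique = proj₁ isE

  enum-sound : ∀ {i t} → t ∈ enum i → size t ≡ i
  enum-sound {i} {t} = proj₁ (proj₂ isE i t)

  enum-complete : ∀ {i t} → size t ≡ i → t ∈ enum i
  enum-complete {i} {t} = proj₂ (proj₂ isE i t)

  prefixBy : ℕ → List (List Tree) → List (List Tree)
  prefixBy i tss = concatMap (λ t → map (t ∷_) tss) (enum i)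

  forests : ℕ → ℕ → List (List Tree)
  forests zero    zero    = [ [] ]
  forests zero    (suc m) = []
  forests (suc j) m       = concatMap (λ i → prefixBy i (forests j (m ∸ i))) (upTo (suc m))

  -- trees n : the trees of size n+1, grouped by root label k and degree j.
  withRoot : ℕ → ℕ → List Tree
  withRoot n k = concatMap (λ j → map (node k) (forests j (n ∸ k))) (upTo (suc n))

  trees : ℕ → List Tree
  trees n = concatMap (withRoot n) (upTo (suc n))

  ∈-prefixBy⁻ : ∀ {i tss us} → us ∈ prefixBy i tss →
                ∃ λ t → ∃ λ ts → us ≡ t ∷ ts × t ∈ enum i × ts ∈ tss
  ∈-prefixBy⁻ {i} us∈
    with t , t∈ , us∈′ ← ∈-concatMap-index (λ t → map (t ∷_) _) {enum i} us∈
    with ts , ts∈ , refl ← ∈-map⁻ (t ∷_) us∈′ = t , ts , refl , t∈ , ts∈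

  forests-sound : ∀ j m {ts} → ts ∈ forests j m → length ts ≡ j × sizeF ts ≡ m
  forests-sound zero    zero    (here refl) = refl , refl
  forests-sound (suc j) m ts∈
    with i , i∈ , ts∈′ ← ∈-concatMap-index _ {upTo (suc m)} ts∈
    with t , ts′ , refl , t∈ , ts′∈ ← ∈-prefixBy⁻ ts∈′
    with length≡ , size≡ ← forests-sound j (m ∸ i) ts′∈ =
      cong suc length≡ ,
      trans (cong₂ ℕ._+_ (enum-sound t∈) size≡) (m+[n∸m]≡n (≤-pred (∈-upTo⁻ i∈)))

  forests-complete : ∀ ts → ts ∈ forests (length ts) (sizeF ts)
  forests-complete []       = here refl
  forests-complete (t ∷ ts) =
    ∈-concatMap-intro _ (∈-upTo⁺ (s≤s (m≤m+n (size t) (sizeF ts))))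
      (∈-concatMap-intro _ (enum-complete refl)
        (∈-map⁺ (t ∷_) (subst (λ r → ts ∈ forests (length ts) r)
                         (sym (m+n∸m≡n (size t) (sizeF ts))) (forests-complete ts))))

  forests-unique : ∀ j m → Unique (forests j m)
  forests-unique zero    zero    = [] ∷ []
  forests-unique zero    (suc m) = []
  forests-unique (suc j) m =
    concatMap-unique _ first-size prefixBy-unique (upTo⁺ (suc m))
    where
    first-size : ∀ {i i′ us} → us ∈ prefixBy i (forests j (m ∸ i)) →
                 us ∈ prefixBy i′ (forests j (m ∸ i′)) → i ≡ i′
    first-size us∈ us∈′
      with t , _ , refl , t∈ , _ ← ∈-prefixBy⁻ us∈
      with _ , _ , refl , t∈′ , _ ← ∈-prefixBy⁻ us∈′ = trans (sym (enum-sound t∈)) (enum-sound t∈′)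

    prefixBy-unique : ∀ i → Unique (prefixBy i (forests j (m ∸ i)))
    prefixBy-unique i = concatMap-unique _ first-tree
      (λ t → Unique-map⁺ ∷-injectiveʳ (forests-unique j (m ∸ i))) (enum-unique i)
      where
      first-tree : ∀ {t t′ us} → us ∈ map (t ∷_) (forests j (m ∸ i)) →
                   us ∈ map (t′ ∷_) (forests j (m ∸ i)) → t ≡ t′
      first-tree {t} {t′} us∈ us∈′
        with _ , _ , refl ← ∈-map⁻ (t ∷_) us∈
        with _ , _ , e ← ∈-map⁻ (t′ ∷_) us∈′ = ∷-injectiveˡ e

  -- trees n contains exactly the trees of size n+1, each once: a tree is
  -- determined by its root label k ≤ n and its forest of size n-k.
  trees-sound : ∀ n {t} → t ∈ trees n → size t ≡ suc n
  trees-sound n t∈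
    with k , k∈ , t∈′ ← ∈-concatMap-index (withRoot n) {upTo (suc n)} t∈
    with j , _ , t∈″ ← ∈-concatMap-index _ {upTo (suc n)} t∈′
    with ts , ts∈ , refl ← ∈-map⁻ (node k) t∈″ =
      cong suc (trans (cong (k ℕ.+_) (proj₂ (forests-sound j (n ∸ k) ts∈)))
                      (m+[n∸m]≡n (≤-pred (∈-upTo⁻ k∈))))

  trees-complete : ∀ n t → size t ≡ suc n → t ∈ trees n
  trees-complete n (node k ts) size≡ =
    ∈-concatMap-intro (withRoot n) (∈-upTo⁺ (s≤s k≤n))
      (∈-concatMap-intro _ (∈-upTo⁺ (s≤s (≤-trans (length≤sizeF ts) sizeF≤n)))
        (∈-map⁺ (node k) (subst (λ r → ts ∈ forests (length ts) r) sizeF≡ (forests-complete ts))))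
    where
    k+sizeF≡n : k ℕ.+ sizeF ts ≡ n
    k+sizeF≡n = suc-injective size≡
    k≤n : k ≤ n
    k≤n = subst (k ≤_) k+sizeF≡n (m≤m+n k (sizeF ts))
    sizeF≤n : sizeF ts ≤ n
    sizeF≤n = subst (sizeF ts ≤_) k+sizeF≡n (m≤n+m (sizeF ts) k)
    sizeF≡ : sizeF ts ≡ n ∸ k
    sizeF≡ = trans (sym (m+n∸m≡n k (sizeF ts))) (cong (_∸ k) k+sizeF≡n)

  trees-unique : ∀ n → Unique (trees n)
  trees-unique n = concatMap-unique (withRoot n) same-root withRoot-unique (upTo⁺ (suc n))
    where
    same-root : ∀ {k k′ t} → t ∈ withRoot n k → t ∈ withRoot n k′ → k ≡ k′
    same-root {k} {k′} t∈ t∈′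
      with _ , _ , t∈″ ← ∈-concatMap-index _ {upTo (suc n)} t∈
      with _ , _ , refl ← ∈-map⁻ (node k) t∈″
      with _ , _ , t∈‴ ← ∈-concatMap-index _ {upTo (suc n)} t∈′
      with _ , _ , refl ← ∈-map⁻ (node k′) t∈‴ = refl

    withRoot-unique : ∀ k → Unique (withRoot n k)
    withRoot-unique k = concatMap-unique _ same-degree
      (λ j → Unique-map⁺ (λ { refl → refl }) (forests-unique j (n ∸ k))) (upTo⁺ (suc n))
      where
      same-degree : ∀ {j j′ t} → t ∈ map (node k) (forests j (n ∸ k)) →
                    t ∈ map (node k) (forests j′ (n ∸ k)) → j ≡ j′
      same-degree {j} {j′} t∈ t∈′
        with ts , ts∈ , refl ← ∈-map⁻ (node k) t∈
        with _ , ts∈′ , refl ← ∈-map⁻ (node k) t∈′ =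
          trans (sym (proj₁ (forests-sound j (n ∸ k) ts∈))) (proj₁ (forests-sound j′ (n ∸ k) ts∈′))

  trees⇔enum : ∀ n {t} → t ∈ enum (suc n) ⇔ t ∈ trees n
  trees⇔enum n {t} = mk⇔ (λ t∈ → trees-complete n t (enum-sound t∈))
                         (λ t∈ → enum-complete (trees-sound n t∈))

-- The coefficient recurrence

module Recurrence {c ℓ} (R : CommutativeRing c ℓ)
                  (φ : ℕ → ℕ → CommutativeRing.Carrier R) (B : ℕ → CommutativeRing.Carrier R)
                  (enum : ℕ → List Tree) (isE : IsTreeEnumeration enum) where
  open CommutativeRing R hiding (refl; sym; trans)
  open CommutativeRing R using ()
    renaming (refl to ≈-refl; sym to ≈-sym; trans to ≈-trans; reflexive to ≈-reflexive)
  open import Relation.Binary.Reasoning.Setoid setoid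
  open CommutativeSemigroupProperties *-commutativeSemigroup using (interchange)
  open Series R
  open ListSums commutativeSemiring
  open TreeEnumeration enum isE

  F : Series
  F = Fser φ B enum

  weight : Tree → Carrier
  weight t = wφ φ t * hookB B t

  forestWeight : List Tree → Carrier
  forestWeight ts = wφF φ ts * hookBF B ts

  strippedWeight : Tree → Carrier
  strippedWeight (node k ts) = φ k (length ts) * forestWeight ts

  forestWeight-∷ : ∀ t ts → forestWeight (t ∷ ts) ≈ weight t * forestWeight ts
  forestWeight-∷ t ts = interchange _ _ _ _

  weight-root : ∀ t → weight t ≈ B (size t) * strippedWeight t
  weight-root (node k ts) = begin
    (φ k (length ts) * wφF φ ts) * (B (size (node k ts)) * hookBF B ts)
      ≈⟨ interchange _ _ _ _ ⟩
    (φ k (length ts) * B (size (node k ts))) * forestWeight ts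
      ≈⟨ *-congʳ (*-comm _ _) ⟩
    (B (size (node k ts)) * φ k (length ts)) * forestWeight ts
      ≈⟨ *-assoc _ _ _ ⟩
    B (size (node k ts)) * strippedWeight (node k ts) ∎

  sumList≡sumOver : ∀ ts f → sumList ts f ≡ sumOver ts f
  sumList≡sumOver []       f = refl
  sumList≡sumOver (t ∷ ts) f = cong (f t +_) (sumList≡sumOver ts f)

  F-coefficient : ∀ i → F i ≈ sumOver (enum i) weight
  F-coefficient i = ≈-reflexive (sumList≡sumOver (enum i) weight)

  sumOver-upTo : ∀ n f → sumOver (upTo n) f ≈ sumTo n f
  sumOver-upTo zero    f = ≈-refl
  sumOver-upTo (suc n) f = begin
    sumOver (upTo (suc n)) f         ≡⟨ cong (λ xs → sumOver xs f) (sym (upTo-∷ʳ n)) ⟩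
    sumOver (upTo n ++ [ n ]) f      ≈⟨ sumOver-++ (upTo n) f ⟩
    sumOver (upTo n) f + (f n + 0#)  ≈⟨ +-cong (sumOver-upTo n f) (+-identityʳ _) ⟩
    sumTo n f + f n                  ∎

  sumOver-prefixBy : ∀ i tss → sumOver (prefixBy i tss) forestWeight ≈ F i * sumOver tss forestWeight
  sumOver-prefixBy i tss = begin
    sumOver (concatMap (λ t → map (t ∷_) tss) (enum i)) forestWeight
      ≈⟨ sumOver-concatMap _ (enum i) forestWeight ⟩
    sumOver (enum i) (λ t → sumOver (map (t ∷_) tss) forestWeight)
      ≈⟨ sumOver-cong (enum i) (λ {t} _ → first-factor t) ⟩
    sumOver (enum i) (λ t → weight t * sumOver tss forestWeight)
      ≈⟨ sumOver-*ʳ _ (enum i) weight ⟨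
    sumOver (enum i) weight * sumOver tss forestWeight
      ≈⟨ *-congʳ (F-coefficient i) ⟨
    F i * sumOver tss forestWeight ∎
    where
    first-factor : ∀ t → sumOver (map (t ∷_) tss) forestWeight ≈ weight t * sumOver tss forestWeight
    first-factor t = begin
      sumOver (map (t ∷_) tss) forestWeight               ≡⟨ sumOver-map (t ∷_) tss forestWeight ⟩
      sumOver tss (λ ts → forestWeight (t ∷ ts))          ≈⟨ sumOver-cong tss (λ {ts} _ → forestWeight-∷ t ts) ⟩
      sumOver tss (λ ts → weight t * forestWeight ts)     ≈⟨ sumOver-*ˡ (weight t) tss forestWeight ⟨
      weight t * sumOver tss forestWeight                 ∎

  pow-forests : ∀ j m → pow F j m ≈ sumOver (forests j m) forestWeight
  pow-forests zero    zero    = ≈-sym (≈-trans (+-identityʳ _) (*-identityˡ 1#))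
  pow-forests zero    (suc m) = ≈-refl
  pow-forests (suc j) m       = ≈-sym (begin
    sumOver (concatMap (λ i → prefixBy i (forests j (m ∸ i))) (upTo (suc m))) forestWeight
      ≈⟨ sumOver-concatMap (λ i → prefixBy i (forests j (m ∸ i))) (upTo (suc m)) forestWeight ⟩
    sumOver (upTo (suc m)) (λ i → sumOver (prefixBy i (forests j (m ∸ i))) forestWeight)
      ≈⟨ sumOver-cong (upTo (suc m)) (λ {i} _ → ≈-trans (sumOver-prefixBy i _)
                                                   (*-congˡ (≈-sym (pow-forests j (m ∸ i))))) ⟩
    sumOver (upTo (suc m)) (λ i → F i * pow F j (m ∸ i))
      ≈⟨ sumOver-upTo (suc m) _ ⟩
    pow F (suc j) m ∎)

  compose-trees : ∀ n → compose φ F n ≈ sumOver (trees n) strippedWeight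
  compose-trees n = ≈-sym (begin
    sumOver (concatMap (withRoot n) (upTo (suc n))) strippedWeight
      ≈⟨ sumOver-concatMap (withRoot n) (upTo (suc n)) strippedWeight ⟩
    sumOver (upTo (suc n)) (λ k → sumOver (withRoot n k) strippedWeight)
      ≈⟨ sumOver-cong (upTo (suc n)) (λ {k} _ → root-sum k) ⟩
    sumOver (upTo (suc n)) (λ k → sumTo (suc n) (λ j → φ k j * pow F j (n ∸ k)))
      ≈⟨ sumOver-upTo (suc n) _ ⟩
    compose φ F n ∎)
    where
    root-degree-sum : ∀ k j → sumOver (map (node k) (forests j (n ∸ k))) strippedWeight
                              ≈ φ k j * pow F j (n ∸ k)
    root-degree-sum k j = begin
      sumOver (map (node k) (forests j (n ∸ k))) strippedWeight
        ≡⟨ sumOver-map (node k) (forests j (n ∸ k)) strippedWeight ⟩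
      sumOver (forests j (n ∸ k)) (λ ts → φ k (length ts) * forestWeight ts)
        ≈⟨ sumOver-cong (forests j (n ∸ k)) (λ {ts} ts∈ →
             ≈-reflexive (cong (λ l → φ k l * forestWeight ts) (proj₁ (forests-sound j (n ∸ k) ts∈)))) ⟩
      sumOver (forests j (n ∸ k)) (λ ts → φ k j * forestWeight ts)
        ≈⟨ sumOver-*ˡ (φ k j) (forests j (n ∸ k)) forestWeight ⟨
      φ k j * sumOver (forests j (n ∸ k)) forestWeight
        ≈⟨ *-congˡ (pow-forests j (n ∸ k)) ⟨
      φ k j * pow F j (n ∸ k) ∎

    root-sum : ∀ k → sumOver (withRoot n k) strippedWeight
                     ≈ sumTo (suc n) (λ j → φ k j * pow F j (n ∸ k))
    root-sum k = ≈-trans (sumOver-concatMap (λ j → map (node k) (forests j (n ∸ k)))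
                                            (upTo (suc n)) strippedWeight)
      (≈-trans (sumOver-cong (upTo (suc n)) (λ {j} _ → root-degree-sum k j))
               (sumOver-upTo (suc n) _))

  coefficient-recurrence : ∀ n → F (suc n) ≈ B (suc n) * compose φ F n
  coefficient-recurrence n = begin
    F (suc n)                                       ≈⟨ F-coefficient (suc n) ⟩
    sumOver (enum (suc n)) weight
      ≈⟨ sumOver-unique weight (enum-unique (suc n)) (trees-unique n) (trees⇔enum n) ⟩
    sumOver (trees n) weight
      ≈⟨ sumOver-cong (trees n) (λ {t} t∈ →
           ≈-trans (weight-root t) (≈-reflexive (cong (λ s → B s * strippedWeight t) (trees-sound n t∈)))) ⟩
    sumOver (trees n) (λ t → B (suc n) * strippedWeight t)
      ≈⟨ sumOver-*ˡ (B (suc n)) (trees n) strippedWeight ⟨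
    B (suc n) * sumOver (trees n) strippedWeight    ≈⟨ *-congˡ (compose-trees n) ⟨
    B (suc n) * compose φ F n                       ∎

  -- There are no trees of size 0, so F has no constant term.
  F-constant : F 0 ≈ 0#
  F-constant with enum 0 | enum-sound {0}
  ... | []           | _         = ≈-refl
  ... | node _ _ ∷ _ | size-zero with () ← size-zero (here refl)

  -- Part (2):  F = L_B(φ(z, F)), the recurrence together with the constant term.
  F≋L : F ≋ L B (compose φ F)
  F≋L zero    = F-constant
  F≋L (suc n) = coefficient-recurrence n

  -- Part (3):  F′ = L_B^*(1+θ)(φ(z, F)), the recurrence multiplied by n+1.
  deriv≋Lstar : deriv F ≋ Lstar B (compose φ F)
  deriv≋Lstar n = ≈-trans (*-congˡ (coefficient-recurrence n)) (≈-sym (*-assoc _ _ _))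

theorem2 : ∀ {c ℓ} (K : Field c ℓ) →
    let open Field K in
    let open Series commutativeRing in
    (φ : ℕ → ℕ → Carrier) (B : ℕ → Carrier) (enum : ℕ → List Tree) →
    IsTreeEnumeration enum →
    ((∀ n → Fser φ B enum (suc n) ≈ B (suc n) * compose φ (Fser φ B enum) n)
    × (Fser φ B enum ≋ L B (compose φ (Fser φ B enum)))
    × (deriv (Fser φ B enum) ≋ Lstar B (compose φ (Fser φ B enum))))
theorem2 K φ B enum isE = coefficient-recurrence , F≋L , deriv≋Lstar
  where open Recurrence (Field.commutativeRing K) φ B enum isE
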